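{- Let $k$ be a positive integer. (1) Let $t\ge 2$ be an integer, $D=\{t^i: i\in\mathbb{N}\}$, and let $M\subseteq\mathbb{N}$ contain at most one element of every residue class modulo $t$. Then $m_{D,M}(k)\le |M|\,(m_{\mathcal{B}}(k)-1)+1$. (2) Let $k\ge 2$, let $p,q>1$ be coprime integers and $D=\{p^iq^j: i,j\in\mathbb{N}\}$. Then $m_{D,\{0\}}(k)=\infty$.
   Context: $\mathbb{N}$ denotes the natural numbers including $0$. For $D,M\subseteq\mathbb{N}$, $\mathcal{A}_{D,M}$ is the family of hypergraphs $A$ with finite vertex set $S\subseteq\mathbb{N}$ each of whose edges has the form $\{a+nd: 0\le n\le \ell\}\cap S$, where $\ell\in\mathbb{N}$, $d\in D$ and $a\in\mathbb{N}$ are such that $a-md\in M$ for some $m\in\mathbb{N}$ (intersection of $S$ with a finite arithmetic progression with difference in $D$ which, extended backwards, meets $M$). The family $\mathcal{B}$ consists of hypergraphs $H=(V,E)$ with $V\subset\mathbb{R}^2$ finite and every edge of the form $\{(x,y)\in V: x_0<x<x_1,\ y<y_0\}$ for some $x_0,x_1,y_0\in\mathbb{R}$ (bottomless rectangles). A polychromatic $k$-coloring of a hypergraph is a coloring of its vertices with $k$ colors such that every edge contains a vertex of each color. $H_{\ge m}$ is obtained from $H$ by deleting all edges of size less than $m$. For a hypergraph family $\mathcal{H}$, $m_{\mathcal{H}}(k)$ is the smallest positive integer $m$ such that $H_{\ge m}$ has a polychromatic $k$-coloring for every $H\in\mathcal{H}$ ($\infty$ if none exists); $m_{D,M}(k):=m_{\mathcal{A}_{D,M}}(k)$.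 -}

module Defs where

open import Data.Nat using (ℕ; zero; suc; _+_; _*_; _∸_; _^_; _≤_; _<_)
import Data.Nat as ℕ
open import Data.Nat.Divisibility using (_∣_)
open import Data.Fin using (Fin)
open import Data.List using (List; []; _∷_; length; filter; map; upTo)
open import Data.List.Membership.Propositional using (_∈_)
open import Data.List.Membership.DecPropositional ℕ._≟_ using (_∈?_)
open import Data.List.Relation.Unary.Unique.Propositional using (Unique)
open import Data.Product using (Σ; ∃; ∃-syntax; _×_; _,_)
open import Data.Product.Properties using (≡-dec)
open import Relation.Nullary using (¬_; Dec)
open import Relation.Nullary.Decidable using (_×-dec_)
open import Relation.Binary.PropositionalEquality using (_≡_)
open import Data.Rational using (ℚ)
import Data.Rational as ℚ
import Data.Rational.Properties as ℚP

-- Generic finite hypergraphs with vertices in a type V.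
-- An edge is given as the (duplicate-free) list of its vertices;
-- the edge set is indexed by an arbitrary type Idx.

record Hypergraph (V : Set) : Set₁ where
  field
    vertices : List V
    Idx      : Set
    edge     : Idx → List V
open Hypergraph public

-- Polychromatic k-coloring of H_{≥ m}: every edge of size ≥ m
-- contains a vertex of each of the k colors.
PolyColorable≥ : {V : Set} → ℕ → ℕ → Hypergraph V → Set
PolyColorable≥ {V} k m H =
  Σ (V → Fin k) λ c →
    ∀ (e : Idx H) → m ≤ length (edge H e) →
      ∀ (j : Fin k) → ∃[ v ] (v ∈ edge H e × c v ≡ j)

Family : Set → Set₁
Family V = Hypergraph V → Set

AllColorable : {V : Set} → Family V → ℕ → ℕ → Set₁
AllColorable {V} 𝓗 k m = (H : Hypergraph V) → 𝓗 H → PolyColorable≥ k m H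

data ℕ∞ : Set where
  fin : ℕ → ℕ∞
  ∞   : ℕ∞

data _≤∞_ : ℕ∞ → ℕ∞ → Set where
  fin≤fin : ∀ {a b} → a ≤ b → fin a ≤∞ fin b
  _≤∞∞    : ∀ a → a ≤∞ ∞

IsM : {V : Set} → Family V → ℕ → ℕ∞ → Set₁
IsM 𝓗 k (fin m) =
  1 ≤ m × AllColorable 𝓗 k m × (∀ m' → 1 ≤ m' → m' < m → ¬ AllColorable 𝓗 k m')
IsM 𝓗 k ∞ = ∀ m → 1 ≤ m → ¬ AllColorable 𝓗 k m

bound : ℕ → ℕ∞ → ℕ∞
bound n (fin b) = fin (n * (b ∸ 1) + 1)
bound n ∞       = ∞

APlist : ℕ → ℕ → ℕ → List ℕ
APlist a d ℓ = map (λ n → a + n * d) (upTo (suc ℓ))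

APedge : List ℕ → ℕ → ℕ → ℕ → List ℕ
APedge S a d ℓ = filter (λ x → x ∈? APlist a d ℓ) S

-- D is a predicate on ℕ, M a finite set given as a duplicate-free list.
-- a - m d ∈ M for some m ∈ ℕ  ⇔  a = b + m d for some b ∈ M, m ∈ ℕ.
𝒜 : (ℕ → Set) → List ℕ → Family ℕ
𝒜 D M H =
  Unique (vertices H) ×
  (∀ (e : Idx H) → ∃[ a ] ∃[ d ] ∃[ ℓ ]
      (D d × (∃[ b ] ∃[ m ] (b ∈ M × a ≡ b + m * d))
           × edge H e ≡ APedge (vertices H) a d ℓ))

Point : Set
Point = ℚ × ℚ

inBR? : (x₀ x₁ y₀ : ℚ) → (p : Point) → Dec (x₀ ℚ.< Data.Product.proj₁ p × Data.Product.proj₁ p ℚ.< x₁ × Data.Product.proj₂ p ℚ.< y₀)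
inBR? x₀ x₁ y₀ (x , y) = (x₀ ℚP.<? x) ×-dec ((x ℚP.<? x₁) ×-dec (y ℚP.<? y₀))

BRedge : List Point → ℚ → ℚ → ℚ → List Point
BRedge V x₀ x₁ y₀ = filter (inBR? x₀ x₁ y₀) V

𝓑 : Family Point
𝓑 H =
  Unique (vertices H) ×
  (∀ (e : Idx H) → ∃[ x₀ ] ∃[ x₁ ] ∃[ y₀ ] (edge H e ≡ BRedge (vertices H) x₀ x₁ y₀))

PowersOf : ℕ → ℕ → Set
PowersOf t d = ∃[ i ] (d ≡ t ^ i)

PowersOf2 : ℕ → ℕ → ℕ → Set
PowersOf2 p q d = ∃[ i ] ∃[ j ] (d ≡ p ^ i * q ^ j)

OnePerClass : ℕ → List ℕ → Set
OnePerClass t M = ∀ x y → x ∈ M → y ∈ M → x ≤ y → t ∣ (y ∸ x) → x ≡ y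

-- (1) Send each vertex x to the element b of M in its residue class modulo t and to the point
-- (x + 1, B - v(x - b)), where v is the t-adic valuation capped at a large B, and colour each class with
-- its own bottomless-rectangle colouring.  An edge with difference t^i, i ≥ 1, lies inside one class b,
-- and its vertices are exactly the class-b points under the bottomless rectangle spanned by its x-range
-- and height B - i.  An edge with difference 1 and |M| (m_𝓑 - 1) + 1 vertices has m_𝓑 vertices in one
-- class by pigeonhole, and those are again cut out by a rectangle.
--
-- (2) Given a threshold m, encode node j at depth h of the complete (m+1)-ary tree of depth m as
-- p^last q^(K - first) U^h, where [first, last] is its interval of leaves.  The multiples of
-- p^s q^(K - e) are the nodes whose interval meets [s, e], so every root-to-leaf path is an edge, and so
-- is every set of siblings once the factor U^h is used to cut out a single depth.  Colour the tree with
-- colour 0 against the other colours and walk down from the root, always to a child with the root's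
-- colour: a node without such a child has a monochromatic set of children, and otherwise the walk ends
-- on a monochromatic root-to-leaf path.

module Submission where

open import Defs
open import Data.Bool using (Bool; true; false; not) renaming (_≟_ to _≟ᵇ_)
open import Data.Bool.Properties using (¬-not)
open import Data.Empty using (⊥; ⊥-elim)
open import Data.Fin using (Fin; toℕ)
import Data.Fin as Fin
open import Data.Fin.Properties using (pigeonhole; toℕ<n; toℕ-injective)
open import Data.List using (List; []; _∷_; [_]; length; filter; map; upTo; lookup)
open import Data.List.Properties using (length-++; filter-++; filter-all; filter-accept; map-cong)
open import Data.List.Membership.Propositional using (_∈_; find; lose)
open import Data.List.Membership.Propositional.Properties
  using (∈-filter⁺; ∈-filter⁻; ∈-map⁺; ∈-map⁻; ∈-upTo⁺; ∈-upTo⁻)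
import Data.List.Relation.Unary.All as All
open import Data.List.Relation.Unary.Any using (here; there; index; any?)
open import Data.List.Relation.Unary.Any.Properties using (lookup-index)
open import Data.List.Relation.Unary.Unique.Propositional using (Unique)
import Data.List.Relation.Unary.Unique.Propositional.Properties as Unique
open import Data.Nat
open import Data.Nat.Properties
open import Data.List.Membership.DecPropositional _≟_ using (_∈?_)
open import Data.Nat.DivMod
  using (_%_; _/_; m≡m%n+[m/n]*n; [m+kn]%n≡m%n; m<n*o⇒m/o<n; m*n/n≡m; /-monoˡ-≤; m%n<n; m/n*n≤m; n/1≡n;
         m/n/o≡m/[n*o])
open import Data.Nat.Divisibility
open import Data.Nat.ListAction using (sum)
open import Data.Nat.Tactic.RingSolver using (solve-∀)
open import Data.Product using (∃-syntax; _×_; _,_; proj₁; proj₂)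
open import Data.Rational using (ℚ; mkℚ)
import Data.Rational as ℚ
import Data.Integer as ℤ
import Data.Integer.Properties as ℤ
open import Data.Nat.Coprimality using (Coprime; 1-coprimeTo; coprime-divisor)
import Data.Nat.Coprimality as Coprime
open import Data.Sum using (inj₁; inj₂)
open import Function using (_∘_)
open import Level using (0ℓ)
open import Relation.Nullary using (¬_; yes; no)
open import Relation.Nullary.Decidable using (_×-dec_; isYes)
open import Relation.Unary using (Pred; Decidable)
open import Relation.Binary.PropositionalEquality hiding ([_])

module _ {A : Set} {P Q : Pred A 0ℓ} (P? : Decidable P) (Q? : Decidable Q) where

  length-filter-mono : ∀ xs → (∀ {x} → x ∈ xs → P x → Q x) →
                       length (filter P? xs) ≤ length (filter Q? xs)
  length-filter-mono []       _   = z≤n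
  length-filter-mono (x ∷ xs) P⇒Q with P? x | Q? x
  ... | yes _  | yes _  = s≤s (length-filter-mono xs (P⇒Q ∘ there))
  ... | yes px | no ¬qx = ⊥-elim (¬qx (P⇒Q (here refl) px))
  ... | no _   | yes _  = m≤n⇒m≤1+n (length-filter-mono xs (P⇒Q ∘ there))
  ... | no _   | no _   = length-filter-mono xs (P⇒Q ∘ there)

  length-filter-filter : ∀ xs →
    length (filter Q? (filter P? xs)) ≡ length (filter (λ x → P? x ×-dec Q? x) xs)
  length-filter-filter []       = refl
  length-filter-filter (x ∷ xs) with P? x
  ... | no _ = length-filter-filter xs
  ... | yes _ with Q? x
  ...   | yes _ = cong suc (length-filter-filter xs)
  ...   | no _  = length-filter-filter xs

length-filter-map : ∀ {A B : Set} {Q : Pred B 0ℓ} (Q? : Decidable Q) (f : A → B) xs →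
  length (filter Q? (map f xs)) ≡ length (filter (Q? ∘ f) xs)
length-filter-map Q? f []       = refl
length-filter-map Q? f (x ∷ xs) with Q? (f x)
... | yes _ = cong suc (length-filter-map Q? f xs)
... | no _  = length-filter-map Q? f xs

length-≥-injection : ∀ {A : Set} {n} {xs : List A} (f : Fin n → A) →
  (∀ {i j} → f i ≡ f j → i ≡ j) → (∀ i → f i ∈ xs) → n ≤ length xs
length-≥-injection {xs = xs} f f-injective f∈xs = ≮⇒≥ λ length<n →
  let (i , j , i<j , same-index) = pigeonhole length<n (index ∘ f∈xs) in
  <⇒≢ i<j (cong toℕ (f-injective (begin
    f i                      ≡⟨ lookup-index (f∈xs i) ⟩
    lookup xs (index (f∈xs i)) ≡⟨ cong (lookup xs) same-index ⟩
    lookup xs (index (f∈xs j)) ≡⟨ lookup-index (f∈xs j) ⟨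
    f j                      ∎)))
  where open ≡-Reasoning

module _ {A : Set} (r : A → ℕ) where

  fibre : ℕ → List A → List A
  fibre b = filter (λ x → r x ≟ b)

  length-fibre-∷ : ∀ b x xs → length (fibre b (x ∷ xs)) ≡ length (fibre b [ x ]) + length (fibre b xs)
  length-fibre-∷ b x xs = trans (cong length (filter-++ (λ y → r y ≟ b) [ x ] xs))
                                (length-++ (fibre b [ x ]))

  length-≤-sum-fibres : ∀ bs → (∀ x → r x ∈ bs) → ∀ xs →
                        length xs ≤ sum (map (λ b → length (fibre b xs)) bs)
  length-≤-sum-fibres bs r∈bs []       = z≤n
  length-≤-sum-fibres bs r∈bs (x ∷ xs) = begin
    1 + length xs
      ≤⟨ +-mono-≤ (own-fibre (r∈bs x)) (length-≤-sum-fibres bs r∈bs xs) ⟩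
    sum (map (λ b → length (fibre b [ x ])) bs) + sum (map (λ b → length (fibre b xs)) bs)
      ≡⟨ sum-map-+ bs ⟨
    sum (map (λ b → length (fibre b [ x ]) + length (fibre b xs)) bs)
      ≡⟨ cong sum (map-cong (λ b → length-fibre-∷ b x xs) bs) ⟨
    sum (map (λ b → length (fibre b (x ∷ xs))) bs) ∎
    where
    open ≤-Reasoning
    own-fibre : ∀ {bs} → r x ∈ bs → 1 ≤ sum (map (λ b → length (fibre b [ x ])) bs)
    own-fibre (here refl) =
      m≤n⇒m≤n+o _ (≤-reflexive (cong length (sym (filter-accept (λ y → r y ≟ r x) refl))))
    own-fibre {b ∷ bs} (there p) = ≤-trans (own-fibre p) (m≤n+m _ _)
    sum-map-+ : ∀ {f g : ℕ → ℕ} bs → sum (map (λ b → f b + g b) bs) ≡ sum (map f bs) + sum (map g bs)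
    sum-map-+ []                 = refl
    sum-map-+ {f} {g} (b ∷ bs) rewrite sum-map-+ {f} {g} bs = +-+-swap (f b) (g b) _ _
      where +-+-swap : ∀ a b c d → a + b + (c + d) ≡ a + c + (b + d)
            +-+-swap = solve-∀

length-pos : ∀ {A : Set} {x : A} {xs} → x ∈ xs → 0 < length xs
length-pos (here _)  = z<s
length-pos (there _) = z<s

large-summand : ∀ bs (f : ℕ → ℕ) c → length bs * c < sum (map f bs) → ∃[ b ] (b ∈ bs × c < f b)
large-summand (b ∷ bs) f c lt with c <? f b
... | yes c<fb = b , here refl , c<fb
... | no c≮fb  =
  let (b′ , b′∈bs , c<fb′) = large-summand bs f c (≰⇒> λ le → <⇒≱ lt (+-mono-≤ (≮⇒≥ c≮fb) le))
  in b′ , there b′∈bs , c<fb′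

∈⇒≤sum : ∀ {x xs} → x ∈ xs → x ≤ sum xs
∈⇒≤sum {xs = y ∷ ys} (here refl) = m≤m+n y (sum ys)
∈⇒≤sum {xs = y ∷ ys} (there p)   = ≤-trans (∈⇒≤sum p) (m≤n+m (sum ys) y)

^-monoʳ-∣ : ∀ m {i j} → i ≤ j → m ^ i ∣ m ^ j
^-monoʳ-∣ m {j = j} z≤n     = 1∣ (m ^ j)
^-monoʳ-∣ m       (s≤s i≤j) = *-monoʳ-∣ m (^-monoʳ-∣ m i≤j)

n<m^n : ∀ {m} → 1 < m → ∀ n → n < m ^ n
n<m^n         1<m zero    = s≤s z≤n
n<m^n {m} 1<m (suc n) = begin-strict
  suc n         ≤⟨ n<m^n 1<m n ⟩
  m ^ n         <⟨ m<m*n (m ^ n) m 1<m ⟩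
  m ^ n * m     ≡⟨ *-comm (m ^ n) m ⟩
  m * m ^ n     ∎
  where open ≤-Reasoning
        instance _ = m^n≢0 m n {{>-nonZero (<-trans z<s 1<m)}}

∈-APlist⁻ : ∀ {x a d ℓ} → x ∈ APlist a d ℓ → ∃[ n ] (n ≤ ℓ × x ≡ a + n * d)
∈-APlist⁻ x∈ with ∈-map⁻ _ x∈
... | n , n∈ , x≡ = n , ≤-pred (∈-upTo⁻ n∈) , x≡

∈-APlist⁺ : ∀ {x a d ℓ} n → n ≤ ℓ → x ≡ a + n * d → x ∈ APlist a d ℓ
∈-APlist⁺ n n≤ℓ refl = ∈-map⁺ _ (∈-upTo⁺ (s≤s n≤ℓ))

APlist-bounds : ∀ {x a d ℓ} → x ∈ APlist a d ℓ → a ≤ x × x ≤ a + ℓ * d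
APlist-bounds {a = a} {d} x∈ with ∈-APlist⁻ x∈
... | n , n≤ℓ , refl = m≤m+n a (n * d) , +-monoʳ-≤ a (*-monoˡ-≤ d n≤ℓ)

∈-APlist-∣ : ∀ {x a d ℓ} .{{_ : NonZero d}} → a ≤ x → x ≤ a + ℓ * d → d ∣ x ∸ a →
             x ∈ APlist a d ℓ
∈-APlist-∣ {x} {a} {d} {ℓ} a≤x x≤ (divides n x∸a≡) = ∈-APlist⁺ n n≤ℓ x≡
  where
  x≡ : x ≡ a + n * d
  x≡ = trans (sym (m+[n∸m]≡n a≤x)) (cong (a +_) x∸a≡)
  n≤ℓ : n ≤ ℓ
  n≤ℓ = *-cancelʳ-≤ n ℓ d (begin
    n * d   ≡⟨ x∸a≡ ⟨
    x ∸ a   ≤⟨ ∸-monoˡ-≤ a x≤ ⟩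
    a + ℓ * d ∸ a ≡⟨ m+n∸m≡n a (ℓ * d) ⟩
    ℓ * d   ∎)
    where open ≤-Reasoning

∈-APlist-* : ∀ {v r u d ℓ} .{{_ : NonZero d}} → v ≡ r * d → u ≤ r → v ≤ u * d + ℓ * d →
             v ∈ APlist (u * d) d ℓ
∈-APlist-* {v} {r} {u} {d} refl u≤r v≤ =
  ∈-APlist-∣ (*-monoˡ-≤ d u≤r) v≤ (divides (r ∸ u) (sym (*-distribʳ-∸ d r u)))

ℕ→ℚ : ℕ → ℚ
ℕ→ℚ n = mkℚ (ℤ.+ n) 0 (Coprime.sym (1-coprimeTo n))

ℕ→ℚ-mono-< : ∀ {m n} → m < n → ℕ→ℚ m ℚ.< ℕ→ℚ n
ℕ→ℚ-mono-< {m} {n} m<n =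
  ℚ.*<* (subst₂ ℤ._<_ (sym (ℤ.*-identityʳ (ℤ.+ m))) (sym (ℤ.*-identityʳ (ℤ.+ n))) (ℤ.+<+ m<n))

ℕ→ℚ-cancel-< : ∀ {m n} → ℕ→ℚ m ℚ.< ℕ→ℚ n → m < n
ℕ→ℚ-cancel-< {m} {n} (ℚ.*<* lt) with subst₂ ℤ._<_ (ℤ.*-identityʳ (ℤ.+ m)) (ℤ.*-identityʳ (ℤ.+ n)) lt
... | ℤ.+<+ m<n = m<n

ℕ→ℚ-injective : ∀ {m n} → ℕ→ℚ m ≡ ℕ→ℚ n → m ≡ n
ℕ→ℚ-injective eq = ℤ.+-injective (cong ℚ.numerator eq)

IsM⇒≤∞ : ∀ {V} {𝓗 : Family V} {k a n} → IsM 𝓗 k a → 1 ≤ n → AllColorable 𝓗 k n → a ≤∞ fin n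
IsM⇒≤∞ {a = fin a} {n} (_ , _ , minimal) 1≤n colourable with a ≤? n
... | yes a≤n = fin≤fin a≤n
... | no  a≰n = ⊥-elim (minimal _ 1≤n (≰⇒> a≰n) colourable)
IsM⇒≤∞ {a = ∞} never 1≤n colourable = ⊥-elim (never _ 1≤n colourable)

𝒜-[]-colourable : ∀ {D k m} → 0 < k → AllColorable (𝒜 D []) k m
𝒜-[]-colourable {k = suc _} _ H (_ , AP-edges) = (λ _ → Fin.zero) , λ e → ⊥-elim (no-base e)
  where
  no-base : Idx H → ⊥
  no-base e with AP-edges e
  ... | _ , _ , _ , _ , (_ , _ , () , _) , _

module PowerDifferences (t : ℕ) (1<t : 1 < t) where

  instance
    t≢0 : NonZero t
    t≢0 = >-nonZero (<-trans z<s 1<t)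

  %≡%⇒∣∸ : ∀ {x y} → x % t ≡ y % t → t ∣ y ∸ x
  %≡%⇒∣∸ {x} {y} eq = divides (y / t ∸ x / t) (begin
    y ∸ x                                        ≡⟨ cong₂ _∸_ (m≡m%n+[m/n]*n y t) (m≡m%n+[m/n]*n x t) ⟩
    (y % t + y / t * t) ∸ (x % t + x / t * t)     ≡⟨ cong (λ r → (y % t + y / t * t) ∸ (r + x / t * t)) eq ⟩
    (y % t + y / t * t) ∸ (y % t + x / t * t)     ≡⟨ [m+n]∸[m+o]≡n∸o (y % t) _ _ ⟩
    y / t * t ∸ x / t * t                        ≡⟨ *-distribʳ-∸ t (y / t) (x / t) ⟨
    (y / t ∸ x / t) * t                          ∎)
    where open ≡-Reasoning

  -- Capped at B since every power of t divides 0.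
  valuation : ℕ → ℕ → ℕ
  valuation zero    z = zero
  valuation (suc B) z with t ^ suc B ∣? z
  ... | yes _ = suc B
  ... | no  _ = valuation B z

  ^valuation∣ : ∀ B z → t ^ valuation B z ∣ z
  ^valuation∣ zero    z = 1∣ z
  ^valuation∣ (suc B) z with t ^ suc B ∣? z
  ... | yes t^B∣z = t^B∣z
  ... | no  _     = ^valuation∣ B z

  ∣⇒≤valuation : ∀ {B z i} → i ≤ B → t ^ i ∣ z → i ≤ valuation B z
  ∣⇒≤valuation {zero}  z≤n _ = z≤n
  ∣⇒≤valuation {suc B} {z} {i} i≤B t^i∣z with t ^ suc B ∣? z
  ... | yes _      = i≤B
  ... | no  t^B∤z  with m≤n⇒m<n∨m≡n i≤B
  ...   | inj₁ i<B  = ∣⇒≤valuation (≤-pred i<B) t^i∣z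
  ...   | inj₂ refl = ⊥-elim (t^B∤z t^i∣z)

  ≤valuation⇒∣ : ∀ {B z i} → i ≤ valuation B z → t ^ i ∣ z
  ≤valuation⇒∣ {B} {z} i≤v = ∣-trans (^-monoʳ-∣ t i≤v) (^valuation∣ B z)

  ∣^min⇒∣ : ∀ {z} B i → z < t ^ B → t ^ (i ⊓ B) ∣ z → t ^ i ∣ z
  ∣^min⇒∣ {z} B i z<t^B ∣z with i ≤? B
  ... | yes i≤B = subst (λ e → t ^ e ∣ z) (m≤n⇒m⊓n≡m i≤B) ∣z
  ... | no  i≰B with z
  ...   | zero  = (t ^ i) ∣0
  ...   | suc _ = ⊥-elim (<⇒≱ z<t^B (∣⇒≤ (subst (λ e → t ^ e ∣ suc _) i⊓B≡B ∣z)))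
    where i⊓B≡B = m≥n⇒m⊓n≡n (<⇒≤ (≰⇒> i≰B))

  module Classes (M : List ℕ) (one-per-class : OnePerClass t M) {b₀ : ℕ} (b₀∈M : b₀ ∈ M) where

    same-residue⇒≡ : ∀ {x y} → x ∈ M → y ∈ M → x % t ≡ y % t → x ≡ y
    same-residue⇒≡ {x} {y} x∈M y∈M eq with ≤-total x y
    ... | inj₁ x≤y = one-per-class x y x∈M y∈M x≤y (%≡%⇒∣∸ eq)
    ... | inj₂ y≤x = sym (one-per-class y x y∈M x∈M y≤x (%≡%⇒∣∸ (sym eq)))

    -- Residues missed by M are sent to b₀.
    class : ℕ → ℕ
    class x with any? (λ b → b % t ≟ x % t) M
    ... | yes found = proj₁ (find found)
    ... | no  _     = b₀

    class∈M : ∀ x → class x ∈ M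
    class∈M x with any? (λ b → b % t ≟ x % t) M
    ... | yes found = proj₁ (proj₂ (find found))
    ... | no  _     = b₀∈M

    class-unique : ∀ {x b} → b ∈ M → b % t ≡ x % t → class x ≡ b
    class-unique {x} b∈M eq with any? (λ b → b % t ≟ x % t) M
    ... | yes found = let (_ , b′∈M , eq′) = find found in same-residue⇒≡ b′∈M b∈M (trans eq′ (sym eq))
    ... | no  none  = ⊥-elim (none (lose b∈M eq))

    module Colouring {k mB : ℕ} (1≤mB : 1 ≤ mB) (colour𝓑 : AllColorable 𝓑 k mB)
                     (S : List ℕ) (S-unique : Unique S) where

      B : ℕ
      B = sum S

      N : ℕ
      N = length M * (mB ∸ 1) + 1

      mB≤N : mB ≤ N
      mB≤N = begin
        mB                  ≡⟨ m∸n+n≡m 1≤mB ⟨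
        mB ∸ 1 + 1          ≤⟨ +-monoˡ-≤ 1 (m≤n*m (mB ∸ 1) (length M)) ⟩
        N                   ∎
        where open ≤-Reasoning
              instance _ = >-nonZero (length-pos b₀∈M)

      ∈S⇒<t^B : ∀ {x} → x ∈ S → x < t ^ B
      ∈S⇒<t^B {x} x∈S = <-≤-trans (n<m^n 1<t x) (^-monoʳ-≤ t (∈⇒≤sum x∈S))

      height : ℕ → ℕ
      height x = B ∸ valuation B (x ∸ class x)

      ∣⇒height≤ : ∀ {x i} → i ≤ B → t ^ i ∣ x ∸ class x → height x ≤ B ∸ i
      ∣⇒height≤ i≤B t^i∣ = ∸-monoʳ-≤ B (∣⇒≤valuation {B} i≤B t^i∣)

      height≤⇒∣ : ∀ {x i} → i ≤ B → height x ≤ B ∸ i → t ^ i ∣ x ∸ class x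
      height≤⇒∣ i≤B height≤ = ≤valuation⇒∣ {B} (≮⇒≥ λ v<i → <⇒≱ (∸-monoʳ-< v<i i≤B) height≤)

      point : ℕ → Point
      point x = ℕ→ℚ (suc x) , ℕ→ℚ (height x)

      point-injective : ∀ {x y} → point x ≡ point y → x ≡ y
      point-injective eq = suc-injective (ℕ→ℚ-injective (cong proj₁ eq))

      classPoints : ℕ → List Point
      classPoints b = map point (fibre class b S)

      classHypergraph : ℕ → Hypergraph Point
      classHypergraph b = record
        { vertices = classPoints b
        ; Idx      = ℚ × ℚ × ℚ
        ; edge     = λ (x₀ , x₁ , y₀) → BRedge (classPoints b) x₀ x₁ y₀
        }

      classHypergraph∈𝓑 : ∀ b → 𝓑 (classHypergraph b)
      classHypergraph∈𝓑 b = Unique.map⁺ point-injective (Unique.filter⁺ _ S-unique)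
                          , λ (x₀ , x₁ , y₀) → x₀ , x₁ , y₀ , refl

      colouring : ∀ b → PolyColorable≥ k mB (classHypergraph b)
      colouring b = colour𝓑 (classHypergraph b) (classHypergraph∈𝓑 b)

      colour : ℕ → Fin k
      colour x = proj₁ (colouring (class x)) (point x)

      Polychromatic : List ℕ → Set
      Polychromatic E = ∀ j → ∃[ v ] (v ∈ E × colour v ≡ j)

      module _ {a d ℓ : ℕ} where

        private
          E = APedge S a d ℓ
          AP? : Decidable (_∈ APlist a d ℓ)
          AP? x = x ∈? APlist a d ℓ

        -- Within class b, E is cut out by the bottomless rectangle (a, a + ℓ d + 2) × (-, B - i + 1).
        rectangle : ∀ b i → i ≤ B → mB ≤ length (fibre class b E) →
          (∀ {x} → x ∈ E → class x ≡ b → t ^ i ∣ x ∸ b) →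
          (∀ {x} → x ∈ S → a ≤ x → x ≤ a + ℓ * d → t ^ i ∣ x ∸ b → x ∈ APlist a d ℓ) →
          Polychromatic E
        rectangle b i i≤B many E⇒R R⇒E j =
          from-R (proj₂ (colouring b) (ℕ→ℚ a , ℕ→ℚ X₁ , ℕ→ℚ Y₀) many-in-R j)
          where
          X₁ = 2 + (a + ℓ * d)
          Y₀ = suc (B ∸ i)
          R? = inBR? (ℕ→ℚ a) (ℕ→ℚ X₁) (ℕ→ℚ Y₀)

          in-R : ∀ {x} → x ∈ S → x ∈ APlist a d ℓ × class x ≡ b →
                 class x ≡ b × ℕ→ℚ a ℚ.< ℕ→ℚ (suc x) × ℕ→ℚ (suc x) ℚ.< ℕ→ℚ X₁
                             × ℕ→ℚ (height x) ℚ.< ℕ→ℚ Y₀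
          in-R {x} x∈S (x∈AP , cls) =
            cls , ℕ→ℚ-mono-< (s≤s a≤x) , ℕ→ℚ-mono-< (s≤s (s≤s x≤)) , ℕ→ℚ-mono-< (s≤s (∣⇒height≤ i≤B t^i∣))
            where
            a≤x = proj₁ (APlist-bounds x∈AP)
            x≤ = proj₂ (APlist-bounds x∈AP)
            t^i∣ = subst (λ c → t ^ i ∣ x ∸ c) (sym cls) (E⇒R (∈-filter⁺ AP? x∈S x∈AP) cls)

          many-in-R : mB ≤ length (BRedge (classPoints b) (ℕ→ℚ a) (ℕ→ℚ X₁) (ℕ→ℚ Y₀))
          many-in-R = begin
            mB                                                        ≤⟨ many ⟩
            length (fibre class b E)                                  ≡⟨ length-filter-filter AP? _ S ⟩
            length (filter (λ x → AP? x ×-dec (class x ≟ b)) S)       ≤⟨ length-filter-mono _ _ S in-R ⟩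
            length (filter (λ x → (class x ≟ b) ×-dec R? (point x)) S) ≡⟨ length-filter-filter _ (R? ∘ point) S ⟨
            length (filter (R? ∘ point) (fibre class b S))            ≡⟨ length-filter-map R? point (fibre class b S) ⟨
            length (filter R? (classPoints b))                        ∎
            where open ≤-Reasoning

          from-R : ∃[ v ] (v ∈ BRedge (classPoints b) (ℕ→ℚ a) (ℕ→ℚ X₁) (ℕ→ℚ Y₀)
                           × proj₁ (colouring b) v ≡ j) →
                   ∃[ x ] (x ∈ E × colour x ≡ j)
          from-R (v , v∈R , colour≡j) with ∈-filter⁻ R? {xs = classPoints b} v∈R
          ... | v∈classPoints , a<v , v<X₁ , height<Y₀ with ∈-map⁻ point {xs = fibre class b S} v∈classPoints
          ...   | x , x∈fibre , refl with ∈-filter⁻ (λ y → class y ≟ b) {xs = S} x∈fibre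
          ...     | x∈S , cls =
            x , ∈-filter⁺ AP? x∈S (R⇒E x∈S a≤x x≤ t^i∣) , trans (cong (λ c → proj₁ (colouring c) (point x)) cls) colour≡j
            where
            a≤x = ≤-pred (ℕ→ℚ-cancel-< a<v)
            x≤ = ≤-pred (≤-pred (ℕ→ℚ-cancel-< v<X₁))
            t^i∣ = subst (λ c → t ^ i ∣ x ∸ c) cls (height≤⇒∣ i≤B (≤-pred (ℕ→ℚ-cancel-< height<Y₀)))

      unit-step-edge : ∀ a ℓ → N ≤ length (APedge S a 1 ℓ) → Polychromatic (APedge S a 1 ℓ)
      unit-step-edge a ℓ N≤ =
        rectangle b 0 z≤n many (λ _ _ → 1∣ _) (λ _ a≤x x≤ _ → ∈-APlist-∣ a≤x x≤ (1∣ _))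
        where
        E = APedge S a 1 ℓ
        crowded-class = large-summand M (λ b → length (fibre class b E)) (mB ∸ 1) (begin-strict
          length M * (mB ∸ 1)                       <⟨ m<m+n _ z<s ⟩
          length M * (mB ∸ 1) + 1                   ≤⟨ N≤ ⟩
          length E                                  ≤⟨ length-≤-sum-fibres class M class∈M E ⟩
          sum (map (λ b → length (fibre class b E)) M) ∎)
          where open ≤-Reasoning
        b = proj₁ crowded-class
        many : mB ≤ length (fibre class b E)
        many = subst (_≤ length (fibre class b E)) (m+[n∸m]≡n 1≤mB) (proj₂ (proj₂ crowded-class))

      power-step-edge : ∀ {b} m i ℓ → b ∈ M →
        let a = b + m * t ^ suc i in
        N ≤ length (APedge S a (t ^ suc i) ℓ) → Polychromatic (APedge S a (t ^ suc i) ℓ)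
      power-step-edge {b} m i ℓ b∈M N≤ = rectangle b (suc i ⊓ B) (m⊓n≤n _ B) many E⇒R R⇒E
        where
        d = t ^ suc i
        a = b + m * d
        E = APedge S a d ℓ
        instance _ = m^n≢0 t (suc i)

        AP⇒shape : ∀ {x} → x ∈ APlist a d ℓ → ∃[ n ] (x ≡ b + (m + n) * t ^ i * t)
        AP⇒shape x∈AP with ∈-APlist⁻ x∈AP
        ... | n , _ , refl = n , reassoc b m n (t ^ i) t
          where reassoc : ∀ b m n u t → b + m * (t * u) + n * (t * u) ≡ b + (m + n) * u * t
                reassoc = solve-∀

        AP⇒class : ∀ {x} → x ∈ APlist a d ℓ → class x ≡ b
        AP⇒class x∈AP with AP⇒shape x∈AP
        ... | n , refl = class-unique b∈M (sym ([m+kn]%n≡m%n b ((m + n) * t ^ i) t))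

        AP⇒∣ : ∀ {x} → x ∈ APlist a d ℓ → d ∣ x ∸ b
        AP⇒∣ x∈AP with AP⇒shape x∈AP
        ... | n , refl = divides (m + n) (trans (m+n∸m≡n b _) (reassoc m n (t ^ i) t))
          where reassoc : ∀ m n u t → (m + n) * u * t ≡ (m + n) * (t * u)
                reassoc = solve-∀

        E⇒AP : ∀ {x} → x ∈ E → x ∈ APlist a d ℓ
        E⇒AP x∈E = proj₂ (∈-filter⁻ (_∈? APlist a d ℓ) {xs = S} x∈E)

        many : mB ≤ length (fibre class b E)
        many = begin
          mB                      ≤⟨ mB≤N ⟩
          N                       ≤⟨ N≤ ⟩
          length E                ≡⟨ cong length (filter-all _ (All.tabulate (AP⇒class ∘ E⇒AP))) ⟨
          length (fibre class b E) ∎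
          where open ≤-Reasoning

        E⇒R : ∀ {x} → x ∈ E → class x ≡ b → t ^ (suc i ⊓ B) ∣ x ∸ b
        E⇒R x∈E _ = ∣-trans (^-monoʳ-∣ t (m⊓n≤m (suc i) B)) (AP⇒∣ (E⇒AP x∈E))

        R⇒E : ∀ {x} → x ∈ S → a ≤ x → x ≤ a + ℓ * d → t ^ (suc i ⊓ B) ∣ x ∸ b → x ∈ APlist a d ℓ
        R⇒E {x} x∈S a≤x x≤ t^i∣ = ∈-APlist-∣ a≤x x≤ (∣m+n∣m⇒∣n (subst (d ∣_) x∸b≡ d∣x∸b) (n∣m*n m))
          where
          d∣x∸b = ∣^min⇒∣ B (suc i) (≤-<-trans (m∸n≤m x b) (∈S⇒<t^B x∈S)) t^i∣
          x∸b≡ : x ∸ b ≡ m * d + (x ∸ a)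
          x∸b≡ = begin
            x ∸ b                     ≡⟨ cong (_∸ b) (m+[n∸m]≡n a≤x) ⟨
            b + m * d + (x ∸ a) ∸ b   ≡⟨ cong (_∸ b) (+-assoc b _ _) ⟩
            b + (m * d + (x ∸ a)) ∸ b ≡⟨ m+n∸m≡n b _ ⟩
            m * d + (x ∸ a)           ∎
            where open ≡-Reasoning

      edge-polychromatic : ∀ {a d ℓ} → PowersOf t d → ∃[ b ] ∃[ m ] (b ∈ M × a ≡ b + m * d) →
                           N ≤ length (APedge S a d ℓ) → Polychromatic (APedge S a d ℓ)
      edge-polychromatic (zero  , refl) _                        = unit-step-edge _ _
      edge-polychromatic (suc i , refl) (_ , m , b∈M , refl) = power-step-edge m i _ b∈M

    colourable : ∀ {k mB} → 1 ≤ mB → AllColorable 𝓑 k mB →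
                 AllColorable (𝒜 (PowersOf t) M) k (length M * (mB ∸ 1) + 1)
    colourable 1≤mB colour𝓑 H (S-unique , AP-edges) = colour , polychromatic
      where
      open Colouring 1≤mB colour𝓑 (vertices H) S-unique
      polychromatic : ∀ e → N ≤ length (edge H e) → Polychromatic (edge H e)
      polychromatic e with AP-edges e
      ... | _ , _ , _ , d∈D , base , edge≡ =
        subst (λ E → N ≤ length E → Polychromatic E) (sym edge≡) (edge-polychromatic d∈D base)

  𝒜-colourable : ∀ {k mB} M → OnePerClass t M → 0 < k → 1 ≤ mB → AllColorable 𝓑 k mB →
                 AllColorable (𝒜 (PowersOf t) M) k (length M * (mB ∸ 1) + 1)
  𝒜-colourable []      _             0<k _    _ = 𝒜-[]-colourable 0<k
  𝒜-colourable (b ∷ M) one-per-class _   1≤mB   = Classes.colourable (b ∷ M) one-per-class (here refl) 1≤mB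

coprime-* : ∀ {a m n} → Coprime a m → Coprime a n → Coprime a (m * n)
coprime-* {a} {m} {n} a⊥m a⊥n (i∣a , i∣mn) = a⊥n (i∣a , coprime-divisor i⊥m i∣mn)
  where i⊥m : Coprime _ m
        i⊥m (j∣i , j∣m) = a⊥m (∣-trans j∣i i∣a , j∣m)

coprime-^ : ∀ {a m} n → Coprime a m → Coprime a (m ^ n)
coprime-^ {a} zero    _   = Coprime.sym (1-coprimeTo a)
coprime-^     (suc n) a⊥m = coprime-* a⊥m (coprime-^ n a⊥m)

coprime⇒∤ : ∀ {a r} → 1 < a → Coprime a r → ¬ a ∣ r
coprime⇒∤ 1<a a⊥r a∣r = <⇒≢ 1<a (sym (a⊥r (∣-refl , a∣r)))

^∣^*⇒≤ : ∀ {a r} α X → 1 < a → Coprime a r → a ^ α ∣ a ^ X * r → α ≤ X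
^∣^*⇒≤ {a} {r} α X 1<a a⊥r a^α∣ = ≮⇒≥ λ X<α → coprime⇒∤ 1<a a⊥r
  (*-cancelˡ-∣ (a ^ X) (subst (_∣ a ^ X * r) (*-comm a (a ^ X)) (∣-trans (^-monoʳ-∣ a X<α) a^α∣)))
  where instance _ = m^n≢0 a X {{>-nonZero (<-trans z<s 1<a)}}

^-split : ∀ a {i n} → i ≤ n → a ^ n ≡ a ^ (n ∸ i) * a ^ i
^-split a {i} {n} i≤n = trans (cong (a ^_) (sym (m∸n+n≡m i≤n))) (^-distribˡ-+-* a (n ∸ i) i)

<suc[/]* : ∀ x n .{{_ : NonZero n}} → x < suc (x / n) * n
<suc[/]* x n = begin-strict
  x                 ≡⟨ m≡m%n+[m/n]*n x n ⟩
  x % n + x / n * n <⟨ +-monoˡ-< (x / n * n) (m%n<n x n) ⟩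
  n + x / n * n     ∎
  where open ≤-Reasoning

^-window-unique : ∀ {u v a b} .{{_ : NonZero u}} →
  u ^ a ≤ v → v < u ^ suc a → u ^ b ≤ v → v < u ^ suc b → a ≡ b
^-window-unique {u} lo₁ hi₁ lo₂ hi₂ =
  ≤-antisym (≤-pred (^-cancel (≤-<-trans lo₁ hi₂))) (≤-pred (^-cancel (≤-<-trans lo₂ hi₁)))
  where ^-cancel : ∀ {x y} → u ^ x < u ^ y → x < y
        ^-cancel lt = ≰⇒> λ y≤x → <⇒≱ lt (^-monoʳ-≤ u y≤x)

*+<suc* : ∀ m {n o} → o < n → m * n + o < suc m * n
*+<suc* m {n} {o} o<n = subst (m * n + o <_) (+-comm (m * n) n) (+-monoʳ-< (m * n) o<n)

/-unique : ∀ {x j n} .{{_ : NonZero n}} → j * n ≤ x → x < suc j * n → x / n ≡ j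
/-unique {x} {j} {n} lo hi = ≤-antisym (≤-pred (m<n*o⇒m/o<n hi))
  (subst (_≤ x / n) (m*n/n≡m j n) (/-monoˡ-≤ n lo))

module Counterexample (p q : ℕ) (1<p : 1 < p) (1<q : 1 < q) (p⊥q : Coprime p q) (m : ℕ) where

  A H K : ℕ
  A = suc m
  H = m
  K = A ^ H

  B : ℕ → ℕ
  B h = A ^ (H ∸ h)

  B≢0 : ∀ h → NonZero (B h)
  B≢0 h = m^n≢0 A (H ∸ h)

  first last : ℕ → ℕ → ℕ
  first h j = j * B h
  last  h j = pred (suc j * B h)

  Valid : ℕ → ℕ → Set
  Valid h j = h ≤ H × j < A ^ h

  Λ U : ℕ
  Λ = p ^ K * q ^ K
  U = suc (p * q * (Λ * suc Λ))

  -- Node j at depth h spans the leaves [first h j, last h j]; divisor s e divides its value exactly when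
  -- that interval meets [s, e], and the factor U^h fixes the depth.
  monomial : ℕ → ℕ → ℕ → ℕ
  monomial X Y h = p ^ X * q ^ Y * U ^ h

  divisor : ℕ → ℕ → ℕ
  divisor s e = p ^ s * q ^ (K ∸ e)

  node : ℕ → ℕ → ℕ
  node h j = monomial (last h j) (K ∸ first h j) h

  instance
    p≢0 : NonZero p
    p≢0 = >-nonZero (<-trans z<s 1<p)
    q≢0 : NonZero q
    q≢0 = >-nonZero (<-trans z<s 1<q)

  divisor≢0 : ∀ s e → NonZero (divisor s e)
  divisor≢0 s e = m*n≢0 (p ^ s) (q ^ (K ∸ e)) {{m^n≢0 p s}} {{m^n≢0 q (K ∸ e)}}

  ∣pq⇒⊥U : ∀ {a} → a ∣ p * q → Coprime a U
  ∣pq⇒⊥U {a} a∣pq {i} (i∣a , i∣U) = ∣1⇒≡1 (∣m+n∣m⇒∣n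
    (subst (i ∣_) (+-comm 1 (p * q * (Λ * suc Λ))) i∣U) (∣m⇒∣m*n (Λ * suc Λ) (∣-trans i∣a a∣pq)))

  p⊥U^ : ∀ h → Coprime p (U ^ h)
  p⊥U^ h = coprime-^ h (∣pq⇒⊥U (m∣m*n q))

  q⊥U^ : ∀ h → Coprime q (U ^ h)
  q⊥U^ h = coprime-^ h (∣pq⇒⊥U (n∣m*n p))

  divisor∣monomial⇒ : ∀ {α β X Y h} → p ^ α * q ^ β ∣ monomial X Y h → α ≤ X × β ≤ Y
  divisor∣monomial⇒ {α} {β} {X} {Y} {h} ∣XY =
      ^∣^*⇒≤ α X 1<p (coprime-* (coprime-^ Y p⊥q) (p⊥U^ h))
        (subst (p ^ α ∣_) (*-assoc (p ^ X) _ _) (∣-trans (m∣m*n (q ^ β)) ∣XY))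
    , ^∣^*⇒≤ β Y 1<q (coprime-* (coprime-^ X (Coprime.sym p⊥q)) (q⊥U^ h))
        (subst (q ^ β ∣_) (reassoc (p ^ X) (q ^ Y) (U ^ h)) (∣-trans (n∣m*n (p ^ α)) ∣XY))
    where reassoc : ∀ a b c → a * b * c ≡ b * (a * c)
          reassoc = solve-∀

  monomial-split : ∀ {α β X Y h} → α ≤ X → β ≤ Y →
                   monomial X Y h ≡ monomial (X ∸ α) (Y ∸ β) h * (p ^ α * q ^ β)
  monomial-split {α} {β} {X} {Y} {h} α≤X β≤Y rewrite ^-split p α≤X | ^-split q β≤Y =
    reassoc (p ^ (X ∸ α)) (p ^ α) (q ^ (Y ∸ β)) (q ^ β) (U ^ h)
    where
    reassoc : ∀ a b c d e → a * b * (c * d) * e ≡ a * c * e * (b * d)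
    reassoc = solve-∀

  1≤B : ∀ h → 1 ≤ B h
  1≤B h = m^n>0 A (H ∸ h)

  B-step : ∀ {h} → h < H → B h ≡ A * B (suc h)
  B-step h<H = cong (A ^_) (+-∸-assoc 1 h<H)

  A^h*B≡K : ∀ {h} → h ≤ H → A ^ h * B h ≡ K
  A^h*B≡K {h} h≤H = trans (sym (^-distribˡ-+-* A h (H ∸ h))) (cong (A ^_) (m+[n∸m]≡n h≤H))

  ≤last⇒< : ∀ {x h j} → x ≤ last h j → x < suc j * B h
  ≤last⇒< {h = h} {j} = m≤pred[n]⇒suc[m]≤n {n = suc j * B h} {{m*n≢0 (suc j) (B h) {{_}} {{B≢0 h}}}}

  first≤last : ∀ h j → first h j ≤ last h j
  first≤last h j = <⇒≤pred {n = suc j * B h} (m<n+m (j * B h) (1≤B h))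

  Valid⇒last<K : ∀ {h j} → Valid h j → last h j < K
  Valid⇒last<K {h} {j} (h≤H , j<A^h) = begin-strict
    last h j     <⟨ ≤last⇒< {h = h} {j} ≤-refl ⟩
    suc j * B h ≤⟨ *-monoˡ-≤ (B h) j<A^h ⟩
    A ^ h * B h ≡⟨ A^h*B≡K h≤H ⟩
    K           ∎
    where open ≤-Reasoning

  _/A^_ : ℕ → ℕ → ℕ
  j /A^ e = _/_ j (A ^ e) {{m^n≢0 A e}}

  /A^0 : ∀ j → j /A^ 0 ≡ j
  /A^0 = n/1≡n

  /A^-step : ∀ {j c} e → c < A → (j * A + c) /A^ suc e ≡ j /A^ e
  /A^-step {j} {c} e c<A = begin
    (j * A + c) /A^ suc e ≡⟨ m/n/o≡m/[n*o] (j * A + c) A (A ^ e) {{_}} {{m^n≢0 A e}} {{m^n≢0 A (suc e)}} ⟨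
    ((j * A + c) / A) /A^ e ≡⟨ cong (_/A^ e) (/-unique (m≤m+n (j * A) c) (*+<suc* j c<A)) ⟩
    j /A^ e               ∎
    where open ≡-Reasoning

  Covers : ℕ → ℕ → ℕ → Set
  Covers h j L = first h j ≤ L × L ≤ last h j

  covers⇒≡/ : ∀ {h j L} → Covers h j L → L /A^ (H ∸ h) ≡ j
  covers⇒≡/ {h} {j} (lo , hi) = /-unique {{B≢0 h}} lo (≤last⇒< {h = h} {j} hi)

  /-covers : ∀ h L → Covers h (L /A^ (H ∸ h)) L
  /-covers h L = m/n*n≤m L (B h) {{B≢0 h}} , <⇒≤pred (<suc[/]* L (B h) {{B≢0 h}})

  /-valid : ∀ {h L} → h ≤ H → L < K → Valid h (L /A^ (H ∸ h))
  /-valid {h} {L} h≤H L<K = h≤H , m<n*o⇒m/o<n {{B≢0 h}} (subst (L <_) (sym (A^h*B≡K h≤H)) L<K)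

  Λ*[1+Λ]<U : Λ * suc Λ < U
  Λ*[1+Λ]<U = s≤s (m≤n*m (Λ * suc Λ) (p * q) {{m*n≢0 p q}})

  Λ<U : Λ < U
  Λ<U = ≤-<-trans (m≤m*n Λ (suc Λ)) Λ*[1+Λ]<U

  U^h≤monomial : ∀ X Y h → U ^ h ≤ monomial X Y h
  U^h≤monomial X Y h = m≤n*m (U ^ h) (p ^ X * q ^ Y) {{m*n≢0 (p ^ X) (q ^ Y) {{m^n≢0 p X}} {{m^n≢0 q Y}}}}

  monomial≤Λ*U^h : ∀ {X Y} h → X ≤ K → Y ≤ K → monomial X Y h ≤ Λ * U ^ h
  monomial≤Λ*U^h h X≤K Y≤K = *-monoˡ-≤ (U ^ h) (*-mono-≤ (^-monoʳ-≤ p X≤K) (^-monoʳ-≤ q Y≤K))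

  Λ*U^h<U^suc : ∀ h → Λ * U ^ h < U ^ suc h
  Λ*U^h<U^suc h = *-monoˡ-< (U ^ h) {{m^n≢0 U h}} Λ<U

  divisor∣node⇒meets : ∀ {s e h j} → Valid h j → divisor s e ∣ node h j → s ≤ last h j × first h j ≤ e
  divisor∣node⇒meets {h = h} {j} valid d∣node =
    let (s≤last , K∸e≤K∸first) = divisor∣monomial⇒ {X = last h j} {K ∸ first h j} {h} d∣node in
    s≤last , ∸-cancelʳ-≤ (<⇒≤ (≤-<-trans (first≤last h j) (Valid⇒last<K valid))) K∸e≤K∸first

  meets⇒node≡ : ∀ {s e h j} → s ≤ last h j → first h j ≤ e →
    node h j ≡ monomial (last h j ∸ s) ((K ∸ first h j) ∸ (K ∸ e)) h * divisor s e
  meets⇒node≡ {h = h} {j} s≤last first≤e =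
    monomial-split {X = last h j} {K ∸ first h j} {h} s≤last (∸-monoʳ-≤ K first≤e)

  node≤Λ*U^h : ∀ {h j} → Valid h j → node h j ≤ Λ * U ^ h
  node≤Λ*U^h {h} {j} valid = monomial≤Λ*U^h h (<⇒≤ (Valid⇒last<K valid)) (m∸n≤m K (first h j))

  IsNode : ℕ → Set
  IsNode v = ∃[ h ] (h < suc H × ∃[ j ] (j < A ^ h × v ≡ node h j))

  IsNode? : Decidable IsNode
  IsNode? v = anyUpTo? (λ h → anyUpTo? (λ j → v ≟ node h j) (A ^ h)) (suc H)

  node-bound : ℕ
  node-bound = suc (Λ * U ^ H)

  node<node-bound : ∀ {h j} → Valid h j → node h j < node-bound
  node<node-bound {h} {j} valid@(h≤H , _) = s≤s (begin
    node h j   ≤⟨ node≤Λ*U^h valid ⟩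
    Λ * U ^ h  ≤⟨ *-monoʳ-≤ Λ (^-monoʳ-≤ U h≤H) ⟩
    Λ * U ^ H  ∎)
    where open ≤-Reasoning

  nodes : List ℕ
  nodes = filter IsNode? (upTo node-bound)

  node∈nodes : ∀ {h j} → Valid h j → node h j ∈ nodes
  node∈nodes valid@(h≤H , j<A^h) =
    ∈-filter⁺ IsNode? (∈-upTo⁺ (node<node-bound valid)) (_ , s≤s h≤H , _ , j<A^h , refl)

  ∈nodes⇒ : ∀ {v} → v ∈ nodes → ∃[ h ] ∃[ j ] (Valid h j × v ≡ node h j)
  ∈nodes⇒ v∈ with proj₂ (∈-filter⁻ IsNode? {xs = upTo node-bound} v∈)
  ... | h , h<1+H , j , j<A^h , v≡ = h , j , (≤-pred h<1+H , j<A^h) , v≡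

  Edge : Set
  Edge = ℕ × ℕ × ℕ × ℕ

  edge-of : Edge → List ℕ
  edge-of (u , i , i′ , ℓ) = APedge nodes (u * (p ^ i * q ^ i′)) (p ^ i * q ^ i′) ℓ

  G : Hypergraph ℕ
  G = record { vertices = nodes ; Idx = Edge ; edge = edge-of }

  G∈𝒜 : 𝒜 (PowersOf2 p q) (0 ∷ []) G
  G∈𝒜 = Unique.filter⁺ IsNode? (Unique.upTo⁺ node-bound)
      , λ (u , i , i′ , ℓ) → _ , _ , ℓ , (i , i′ , refl) , (0 , u , here refl , refl) , refl

  ∈edge⁻ : ∀ {v a d ℓ} → v ∈ APedge nodes a d ℓ →
           (∃[ h ] ∃[ j ] (Valid h j × v ≡ node h j)) × v ∈ APlist a d ℓ
  ∈edge⁻ {a = a} {d} {ℓ} v∈ =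
    let (v∈nodes , v∈AP) = ∈-filter⁻ (_∈? APlist a d ℓ) {xs = nodes} v∈ in ∈nodes⇒ v∈nodes , v∈AP

  node∈edge : ∀ {h j u s e ℓ} → Valid h j → s ≤ last h j → first h j ≤ e → u ≤ U ^ h →
              node h j ≤ u * divisor s e + ℓ * divisor s e →
              node h j ∈ APedge nodes (u * divisor s e) (divisor s e) ℓ
  node∈edge {h} {j} {u} {s} {e} valid s≤last first≤e u≤U^h node≤ =
    ∈-filter⁺ (_∈? _) (node∈nodes valid) (∈-APlist-* (meets⇒node≡ {s} {e} {h} {j} s≤last first≤e) u≤ node≤)
    where instance _ = divisor≢0 s e
          u≤ = ≤-trans u≤U^h (U^h≤monomial (last h j ∸ s) ((K ∸ first h j) ∸ (K ∸ e)) h)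

  node-window : ∀ {h j} → Valid h j → U ^ h ≤ node h j × node h j < U ^ suc h
  node-window {h} {j} valid =
    U^h≤monomial (last h j) (K ∸ first h j) h , ≤-<-trans (node≤Λ*U^h valid) (Λ*U^h<U^suc h)

  node-depth-injective : ∀ {h j h′ j′} → Valid h j → Valid h′ j′ → node h j ≡ node h′ j′ → h ≡ h′
  node-depth-injective {h} {j} {h′} {j′} valid valid′ eq =
    let (lo , hi) = node-window valid ; (lo′ , hi′) = node-window valid′ in
    ^-window-unique lo hi (subst (U ^ h′ ≤_) (sym eq) lo′) (subst (_< U ^ suc h′) (sym eq) hi′)

  node-injective : ∀ {h a b} → node h a ≡ node h b → a ≡ b
  node-injective {h} {a} {b} eq = suc-injective (*-cancelʳ-≡ (suc a) (suc b) (B h) {{B≢0 h}}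
    (pred-injective {{m*n≢0 (suc a) (B h) {{_}} {{B≢0 h}}}} {{m*n≢0 (suc b) (B h) {{_}} {{B≢0 h}}}}
      (≤-antisym (last-mono {a} {b} eq) (last-mono {b} {a} (sym eq)))))
    where
    last-mono : ∀ {a b} → node h a ≡ node h b → last h a ≤ last h b
    last-mono {a} {b} eq =
      ^∣^*⇒≤ (last h a) (last h b) 1<p (coprime-* (coprime-^ (K ∸ first h b) p⊥q) (p⊥U^ h))
      (subst (p ^ last h a ∣_) (trans eq (*-assoc (p ^ last h b) _ _))
        (∣m⇒∣m*n (U ^ h) (m∣m*n (q ^ (K ∸ first h a)))))

  child-valid : ∀ {h j c} → j < A ^ h → c < A → j * A + c < A ^ suc h
  child-valid {h} {j} {c} j<A^h c<A = begin-strict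
    j * A + c  <⟨ *+<suc* j c<A ⟩
    suc j * A  ≤⟨ *-monoˡ-≤ A j<A^h ⟩
    A ^ h * A  ≡⟨ *-comm (A ^ h) A ⟩
    A ^ suc h  ∎
    where open ≤-Reasoning

  *B-step : ∀ {h} x → h < H → x * B h ≡ x * A * B (suc h)
  *B-step {h} x h<H = trans (cong (x *_) (B-step h<H)) (sym (*-assoc x A (B (suc h))))

  child-inside : ∀ {h j c} → h < H → c < A →
                 first h j ≤ first (suc h) (j * A + c) × last (suc h) (j * A + c) ≤ last h j
  child-inside {h} {j} {c} h<H c<A = lo , <⇒≤pred hi
    where
    open ≤-Reasoning
    B′ = B (suc h)
    lo = begin
      j * B h         ≡⟨ *B-step j h<H ⟩
      j * A * B′      ≤⟨ *-monoˡ-≤ B′ (m≤m+n (j * A) c) ⟩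
      (j * A + c) * B′ ∎
    hi = begin-strict
      last (suc h) (j * A + c) <⟨ ≤last⇒< {h = suc h} {j * A + c} ≤-refl ⟩
      suc (j * A + c) * B′     ≤⟨ *-monoˡ-≤ B′ (*+<suc* j c<A) ⟩
      suc j * A * B′           ≡⟨ *B-step (suc j) h<H ⟨
      suc j * B h              ∎

  meets⇒child : ∀ {h j j′} → h < H → first h j ≤ last (suc h) j′ → first (suc h) j′ ≤ last h j →
                j′ ≡ j * A + j′ % A
  meets⇒child {h} {j} {j′} h<H lo hi = begin
    j′                  ≡⟨ m≡m%n+[m/n]*n j′ A ⟩
    j′ % A + j′ / A * A ≡⟨ cong (λ i → j′ % A + i * A) (/-unique {j = j} j*A≤j′ j′<) ⟩
    j′ % A + j * A      ≡⟨ +-comm (j′ % A) (j * A) ⟩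
    j * A + j′ % A      ∎
    where
    open ≡-Reasoning
    B′ = B (suc h)
    instance _ = B≢0 (suc h)
    j*A≤j′ : j * A ≤ j′
    j*A≤j′ = ≤-pred (*-cancelʳ-< B′ (j * A) (suc j′) (≤-<-trans
      (subst (_≤ last (suc h) j′) (*B-step j h<H) lo) (≤last⇒< {h = suc h} {j′} ≤-refl)))
    j′< : j′ < suc j * A
    j′< = *-cancelʳ-< B′ j′ (suc j * A) (subst (j′ * B′ <_) (*B-step (suc j) h<H)
      (≤-<-trans hi (≤last⇒< {h = h} {j} ≤-refl)))

  divisor≤Λ : ∀ {s} e → s ≤ K → divisor s e ≤ Λ
  divisor≤Λ e s≤K = *-mono-≤ (^-monoʳ-≤ p s≤K) (^-monoʳ-≤ q (m∸n≤m K e))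

  -- An AP with difference d ≤ Λ from U^h d of length Λ U^h stays below depth h + 1.
  sibling-top : ∀ h {d} → d ≤ Λ → U ^ h * d + Λ * U ^ h * d < U ^ suc h
  sibling-top h {d} d≤Λ = begin-strict
    U ^ h * d + Λ * U ^ h * d ≡⟨ factor (U ^ h) d Λ ⟩
    U ^ h * (d * suc Λ)       ≤⟨ *-monoʳ-≤ (U ^ h) (*-monoˡ-≤ (suc Λ) d≤Λ) ⟩
    U ^ h * (Λ * suc Λ)       <⟨ *-monoʳ-< (U ^ h) {{m^n≢0 U h}} Λ*[1+Λ]<U ⟩
    U ^ h * U                 ≡⟨ *-comm (U ^ h) U ⟩
    U ^ suc h                 ∎
    where open ≤-Reasoning
          factor : ∀ T d Λ → T * d + Λ * T * d ≡ T * (d * suc Λ)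
          factor = solve-∀

  module _ {k} (colour : ℕ → Fin (2 + k))
           (polychromatic : ∀ e → m ≤ length (edge-of e) → ∀ i → ∃[ v ] (v ∈ edge-of e × colour v ≡ i)) where

    bit : ℕ → Bool
    bit v = isYes (colour v Fin.≟ Fin.zero)

    not-monochromatic : ∀ e b → m ≤ length (edge-of e) → ¬ (∀ {v} → v ∈ edge-of e → bit v ≡ b)
    not-monochromatic e true  big mono with polychromatic e big (Fin.suc Fin.zero)
    ... | v , v∈e , colour≡1 with subst (λ i → isYes (i Fin.≟ Fin.zero) ≡ true) colour≡1 (mono v∈e)
    ...   | ()
    not-monochromatic e false big mono with polychromatic e big Fin.zero
    ... | v , v∈e , colour≡0 with subst (λ i → isYes (i Fin.≟ Fin.zero) ≡ false) colour≡0 (mono v∈e)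
    ...   | ()

    b₀ : Bool
    b₀ = bit (node 0 0)

    -- j /A^ (h ∸ h′) is the ancestor at depth h′ of node j at depth h.
    RootColoured : ℕ → ℕ → Set
    RootColoured h j = ∀ {h′} → h′ ≤ h → bit (node h′ (j /A^ (h ∸ h′))) ≡ b₀

    extend : ∀ {h j c} → RootColoured h j → c < A → bit (node (suc h) (j * A + c)) ≡ b₀ →
             RootColoured (suc h) (j * A + c)
    extend {h} {j} {c} coloured c<A same {h′} h′≤1+h with m≤n⇒m<n∨m≡n h′≤1+h
    ... | inj₂ refl = subst (λ i → bit (node (suc h) i) ≡ b₀)
                        (sym (trans (cong ((j * A + c) /A^_) (n∸n≡0 h)) (/A^0 (j * A + c)))) same
    ... | inj₁ h′<1+h = subst (λ i → bit (node h′ i) ≡ b₀) (sym same-ancestor) (coloured h′≤h)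
      where
      h′≤h = ≤-pred h′<1+h
      same-ancestor = trans (cong ((j * A + c) /A^_) (+-∸-assoc 1 h′≤h)) (/A^-step {j} (h ∸ h′) c<A)

    -- All children of a node of the opposite bit form a monochromatic sibling edge.
    some-child-agrees : ∀ {h j} → h < H → j < A ^ h →
                        ¬ (∀ {c} → c < A → bit (node (suc h) (j * A + c)) ≢ b₀)
    some-child-agrees {h} {j} h<H j<A^h differ = not-monochromatic e (not b₀) big mono
      where
      T = U ^ suc h
      d = divisor (first h j) (last h j)
      e : Edge
      e = T , first h j , K ∸ last h j , Λ * T
      d≤Λ : d ≤ Λ
      d≤Λ = divisor≤Λ (last h j) (<⇒≤ (≤-<-trans (first≤last h j) (Valid⇒last<K (<⇒≤ h<H , j<A^h))))
      instance _ = divisor≢0 (first h j) (last h j)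

      child : Fin m → ℕ
      child c = node (suc h) (j * A + toℕ c)

      child∈e : ∀ c → child c ∈ edge-of e
      child∈e c = node∈edge {suc h} {j′} valid′
        (≤-trans (proj₁ inside) (first≤last (suc h) j′)) (≤-trans (first≤last (suc h) j′) (proj₂ inside)) ≤-refl
        (≤-trans (node≤Λ*U^h valid′) (≤-trans (m≤m*n (Λ * T) d) (m≤n+m _ (T * d))))
        where
        c<A = m≤n⇒m≤1+n (toℕ<n c)
        j′ = j * A + toℕ c
        valid′ : Valid (suc h) j′
        valid′ = h<H , child-valid {h} {j} {toℕ c} j<A^h c<A
        inside = child-inside {h} {j} {toℕ c} h<H c<A

      big : m ≤ length (edge-of e)
      big = length-≥-injection child
        (λ eq → toℕ-injective (+-cancelˡ-≡ (j * A) _ _ (node-injective {suc h} eq))) child∈e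

      in-window : ∀ {v n} → n ≤ Λ * T → v ≡ T * d + n * d → T ≤ v × v < U ^ suc (suc h)
      in-window {v} {n} n≤ΛT v≡ =
          ≤-trans (m≤m*n T d) (≤-trans (m≤m+n (T * d) (n * d)) (≤-reflexive (sym v≡)))
        , ≤-<-trans (≤-trans (≤-reflexive v≡) (+-monoʳ-≤ (T * d) (*-monoˡ-≤ d n≤ΛT))) (sibling-top (suc h) d≤Λ)

      child-bit : ∀ {h′ j′ n} → h′ ≡ suc h → Valid h′ j′ → node h′ j′ ≡ T * d + n * d →
                  bit (node h′ j′) ≡ not b₀
      child-bit {j′ = j′} {n} refl valid′ v≡ =
        ¬-not (subst (λ i → bit (node (suc h) i) ≢ b₀) (sym j′≡) (differ (m%n<n j′ A)))
        where
        meets = divisor∣node⇒meets {first h j} {last h j} {suc h} {j′} valid′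
                  (divides (T + n) (trans v≡ (sym (*-distribʳ-+ d T n))))
        j′≡ = meets⇒child {h} {j} {j′} h<H (proj₁ meets) (proj₂ meets)

      mono : ∀ {v} → v ∈ edge-of e → bit v ≡ not b₀
      mono v∈e with ∈edge⁻ v∈e
      ... | (h′ , j′ , valid′ , refl) , v∈AP with ∈-APlist⁻ v∈AP
      ...   | n , n≤ΛT , v≡ = child-bit {h′} {j′} {n} depth valid′ v≡
        where
        window = node-window valid′
        depth = ^-window-unique (proj₁ window) (proj₂ window)
                  (proj₁ (in-window {n = n} n≤ΛT v≡)) (proj₂ (in-window {n = n} n≤ΛT v≡))

    descend : ∀ h → h ≤ H → ∃[ j ] (j < A ^ h × RootColoured h j)
    descend zero    _   = 0 , z<s , λ { z≤n → refl }
    descend (suc h) h<H with descend h (<⇒≤ h<H)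
    ... | j , j<A^h , coloured with anyUpTo? (λ c → bit (node (suc h) (j * A + c)) ≟ᵇ b₀) A
    ...   | yes (c , c<A , same) =
      j * A + c , child-valid {h} {j} {c} j<A^h c<A , extend {h} {j} {c} coloured c<A same
    ...   | no  none             = ⊥-elim (some-child-agrees h<H j<A^h λ c<A same → none (_ , c<A , same))

    -- The ancestors of a leaf form a monochromatic path edge.
    leaf-path : ∀ {L} → L < K → ¬ RootColoured H L
    leaf-path {L} L<K coloured = not-monochromatic e b₀ big mono
      where
      d = divisor L L
      instance _ = divisor≢0 L L
      e : Edge
      e = 0 , L , K ∸ L , node-bound

      ancestor : Fin m → ℕ
      ancestor i = node (toℕ i) (L /A^ (H ∸ toℕ i))

      ancestor-valid : ∀ i → Valid (toℕ i) (L /A^ (H ∸ toℕ i))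
      ancestor-valid i = /-valid (<⇒≤ (toℕ<n i)) L<K

      ancestor∈e : ∀ i → ancestor i ∈ edge-of e
      ancestor∈e i = node∈edge {toℕ i} {L /A^ (H ∸ toℕ i)} (ancestor-valid i)
        (proj₂ (/-covers (toℕ i) L)) (proj₁ (/-covers (toℕ i) L)) z≤n
        (<⇒≤ (<-≤-trans (node<node-bound (ancestor-valid i)) (m≤m*n node-bound d)))

      big : m ≤ length (edge-of e)
      big = length-≥-injection ancestor
        (λ {i} {i′} eq → toℕ-injective (node-depth-injective (ancestor-valid i) (ancestor-valid i′) eq)) ancestor∈e

      mono : ∀ {v} → v ∈ edge-of e → bit v ≡ b₀
      mono v∈e with ∈edge⁻ v∈e
      ... | (h , j , valid , refl) , v∈AP with ∈-APlist⁻ v∈AP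
      ...   | n , _ , v≡ =
        subst (λ i → bit (node h i) ≡ b₀) (covers⇒≡/ {h} {j} (first≤L , L≤last)) (coloured (proj₁ valid))
        where
        meets = divisor∣node⇒meets {L} {L} {h} {j} valid (divides n v≡)
        L≤last = proj₁ meets
        first≤L = proj₂ meets

    impossible : ⊥
    impossible = let (L , L<K , coloured) = descend H ≤-refl in leaf-path L<K coloured

  not-colourable : ∀ {k} → ¬ AllColorable (𝒜 (PowersOf2 p q) (0 ∷ [])) (2 + k) m
  not-colourable colourable =
    let (colour , polychromatic) = colourable G G∈𝒜 in impossible colour polychromatic

𝒜-powers-≤-bound : ∀ {k} → 1 ≤ k →
  (t : ℕ) → 2 ≤ t → (M : List ℕ) → Unique M → OnePerClass t M →
  (a b : ℕ∞) → IsM (𝒜 (PowersOf t) M) k a → IsM 𝓑 k b → a ≤∞ bound (length M) b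
𝒜-powers-≤-bound 1≤k t 2≤t M _ one-per-class a ∞        _    _                         = a ≤∞∞
𝒜-powers-≤-bound 1≤k t 2≤t M _ one-per-class a (fin mB) m𝒜≡a (1≤mB , 𝓑-colourable , _) =
  IsM⇒≤∞ m𝒜≡a (m≤n+m 1 _) (PowerDifferences.𝒜-colourable t 2≤t M one-per-class 1≤k 1≤mB 𝓑-colourable)

𝒜-products-∞ : ∀ {k} → 2 ≤ k → (p q : ℕ) → 1 < p → 1 < q → Coprime p q →
  IsM (𝒜 (PowersOf2 p q) (0 ∷ [])) k ∞
𝒜-products-∞ (s≤s (s≤s z≤n)) p q 1<p 1<q p⊥q m _ = Counterexample.not-colourable p q 1<p 1<q p⊥q m

theorem7 : (k : ℕ) → 1 ≤ k →
    ((t : ℕ) → 2 ≤ t → (M : List ℕ) → Unique M → OnePerClass t M →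
       (a b : ℕ∞) → IsM (𝒜 (PowersOf t) M) k a → IsM 𝓑 k b →
       a ≤∞ bound (length M) b)
    ×
    (2 ≤ k → (p q : ℕ) → 1 < p → 1 < q → Coprime p q →
       IsM (𝒜 (PowersOf2 p q) (0 ∷ [])) k ∞)
theorem7 k 1≤k = 𝒜-powers-≤-bound 1≤k , 𝒜-products-∞
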